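{- The edge-forcing number of the butterfly network $BF(4)$ is at least $25$: $\zeta_e(BF(4))\ge 25$.
   Context: The $r$-dimensional butterfly network $BF(r)$ has vertex set $\{[w;i] : w\in\{0,1\}^r,\ 0\le i\le r\}$, and $[w;i]$ is adjacent to $[w';j]$ iff $j=i+1$ and either $w=w'$ or $w$ and $w'$ differ precisely in the $j$-th bit. Forcing (closure) rule: for a graph $G=(V,E)$ and $T\subseteq V$, the closure $C_G(T)$ starts as $T$ and, as long as some vertex of $C_G(T)$ has exactly one neighbor not in $C_G(T)$, that neighbor is added. Edge-forcing set: a set $K$ of pairwise independent edges of $G$ such that, with $T$ the set of endpoints of edges of $K$, $C_G(T)=V$. $\zeta_e(G)$ is the minimum cardinality of an edge-forcing set of $G$. -}

module Defs where

open import Data.Bool using (Bool)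
open import Data.Nat using (ℕ; suc; _≤_)
open import Data.Fin using (Fin; toℕ)
open import Data.Vec using (Vec; lookup)
open import Data.Product using (_×_; _,_; proj₁; proj₂; Σ)
open import Data.Sum using (_⊎_)
open import Data.List using (List; length)
open import Data.List.Relation.Unary.All using (All)
open import Data.List.Relation.Unary.AllPairs using (AllPairs)
open import Relation.Binary.PropositionalEquality using (_≡_; _≢_)


record Graph : Set₁ where
  field
    V   : Set
    Adj : V → V → Set

open Graph public

BFVertex : ℕ → Set
BFVertex r = Vec Bool r × Fin (Data.Nat.suc r)

-- w and w' differ precisely in the j-th bit (bits numbered 1..r;
-- position p : Fin r is bit number 1 + toℕ p)
DifferPreciselyIn : ∀ {r} → Vec Bool r → Vec Bool r → ℕ → Set
DifferPreciselyIn {r} w w' j =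
  (p : Fin r) →
    (Data.Nat.suc (toℕ p) ≡ j → lookup w p ≢ lookup w' p)
  × (Data.Nat.suc (toℕ p) ≢ j → lookup w p ≡ lookup w' p)

BFArc : ∀ {r} → BFVertex r → BFVertex r → Set
BFArc (w , i) (w' , j) =
  (toℕ j ≡ Data.Nat.suc (toℕ i)) × (w ≡ w' ⊎ DifferPreciselyIn w w' (toℕ j))

BF : ℕ → Graph
BF r = record
  { V   = BFVertex r
  ; Adj = λ x y → BFArc x y ⊎ BFArc y x
  }

-- Forcing closure C_G(T): the set obtained from T by repeatedly adding
-- the unique neighbour outside the current set of some vertex of the set.
-- Rendered as the least set containing T and closed under this forcing
-- rule (an inductive family).

data InClosure (G : Graph) (T : V G → Set) : V G → Set where
  base  : ∀ {v} → T v → InClosure G T v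
  force : ∀ {v} (u : V G) → InClosure G T u → Adj G u v →
          (∀ w → Adj G u w → w ≢ v → InClosure G T w) →
          InClosure G T v

Edge : Graph → Set
Edge G = V G × V G

Independent : (G : Graph) → Edge G → Edge G → Set
Independent G (a , b) (c , d) = (a ≢ c) × (a ≢ d) × (b ≢ c) × (b ≢ d)

Endpoint : (G : Graph) → List (Edge G) → V G → Set
Endpoint G K v = Data.List.Relation.Unary.Any.Any (λ e → (v ≡ proj₁ e) ⊎ (v ≡ proj₂ e)) K
  where import Data.List.Relation.Unary.Any

-- K (given as a list, whose elements are pairwise independent hence
-- distinct, so |K| = length K) is an edge-forcing set of G
IsEdgeForcingSet : (G : Graph) → List (Edge G) → Set
IsEdgeForcingSet G K =
    All (λ e → Adj G (proj₁ e) (proj₂ e)) K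
  × AllPairs (Independent G) K
  × (∀ v → InClosure G (Endpoint G K) v)

-- A fort is a nonempty vertex set F such that no vertex outside F has exactly one neighbour in F. The closure of a
-- set disjoint from a fort stays disjoint from it, so the endpoints T of an edge-forcing set K meet every fort.
-- Every edge of BF(4) joins consecutive levels, so at most |K| vertices of T lie on the even levels 0, 2, 4.
-- The 8 pairs of level-0 vertices differing in bit 1, the 8 pairs of level-4 vertices differing in bit 4, and the
-- 4 quadrants of level-2 vertices with fixed bits 1 and 4 are forts, so T meets each of them. If |K| ≤ 24, this
-- leaves a budget of 8 for the hits in the quadrants plus one for every group of two pairs containing a fully hit
-- pair. For each of the finitely many distributions within this budget, a search (checked here by evaluation)
-- labels some groups of pairs and completes their unhit vertices by a part of each quadrant to a fort avoiding T,
-- which is impossible.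

module Submission where

open import Defs
open import Data.Bool using (Bool; true; false; _∧_; _∨_; not; _xor_; if_then_else_; T)
import Data.Bool as Bool
open import Data.Bool.Properties
  using (∧-comm; ∨-comm; ∧-distribˡ-∨; ∧-conicalˡ; ∧-conicalʳ; ∨-conicalˡ; ∨-conicalʳ; ∨-zeroʳ; xor-comm;
         not-involutive; ¬-not; not-¬)
open import Data.Bool.ListAction using (all; any)
open import Data.Nat using (ℕ; zero; suc; _+_; _∸_; _≤_; _≤ᵇ_; _≡ᵇ_; z≤n; s≤s; _≤?_)
open import Data.Nat.Properties
  using (≤-refl; ≤-reflexive; ≤-trans; +-comm; +-assoc; +-identityʳ; +-mono-≤; +-monoʳ-≤; +-cancelˡ-≤; ≤⇒≤ᵇ;
         ∸-+-assoc; m+n≤o⇒m≤o; m+n≤o⇒m≤o∸n)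
import Data.Nat.Properties as ℕ
open import Data.Nat.Tactic.RingSolver using (solve-∀)
open import Data.Fin using (Fin; zero; suc; toℕ; inject₁)
import Data.Fin as Fin
open import Data.Fin.Properties using (toℕ-injective; toℕ-inject₁)
open import Data.Vec using (Vec; []; _∷_; lookup; updateAt; tabulate)
import Data.Vec as Vec
open import Data.Vec.Properties
  using (lookup∘updateAt; lookup∘updateAt′; updateAt-updateAt-local; updateAt-id; tabulate∘lookup; tabulate-cong)
import Data.Vec.Properties as VecP
open import Data.List using (List; []; _∷_; length; _++_; map; allFin; cartesianProduct)
open import Data.List.Membership.Propositional using (_∈_)
open import Data.List.Membership.Propositional.Properties
  using (∈-++⁺ˡ; ∈-++⁺ʳ; ∈-map⁺; ∈-allFin; ∈-cartesianProduct⁺)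
open import Data.List.Relation.Unary.All as All using (All; []; _∷_)
open import Data.List.Relation.Unary.Any using (here; there)
open import Data.List.Relation.Unary.AllPairs using ([]; _∷_)
open import Data.List.Relation.Unary.Unique.Propositional using (Unique)
open import Data.Product using (∃-syntax; _×_; _,_; proj₁; proj₂)
import Data.Product.Properties as ×
open import Data.Sum using (_⊎_; inj₁; inj₂)
import Data.Sum as Sum
open import Data.Empty using (⊥; ⊥-elim)
open import Data.Unit using (tt)
open import Function using (_∘_)
open import Relation.Binary.Definitions using (DecidableEquality)
open import Relation.Binary.PropositionalEquality
  using (_≡_; refl; sym; trans; cong; cong₂; subst; _≢_; module ≡-Reasoning)
open import Relation.Nullary using (¬_; Dec; yes; no; does)
open import Relation.Nullary.Decidable using (dec-true)

IsFort : (G : Graph) → (V G → Set) → Set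
IsFort G F = ∀ {u v} → F v → Adj G u v → ∃[ w ] Adj G u w × w ≢ v × F w

closure-avoids-fort : ∀ {G T F} → IsFort G F → (∀ {v} → T v → ¬ F v) →
                      ∀ {v} → InClosure G T v → ¬ F v
closure-avoids-fort fort T∩F=∅ (base Tv) = T∩F=∅ Tv
closure-avoids-fort fort T∩F=∅ (force u _ u~v others) Fv with fort Fv u~v
... | w , u~w , w≢v , Fw = closure-avoids-fort fort T∩F=∅ (others w u~w w≢v) Fw

forcing-set-meets-fort : ∀ {G T F} → (∀ v → InClosure G T v) → IsFort G F →
                         ∀ {v} → F v → ¬ (∀ {u} → T u → ¬ F u)
forcing-set-meets-fort closed fort {v} Fv T∩F=∅ = closure-avoids-fort fort T∩F=∅ (closed v) Fv

true≢false : true ≢ false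
true≢false ()

not-true : ∀ {a} → not a ≡ true → a ≡ false
not-true {false} _ = refl

nand-sound : ∀ {u s} → not (u ∧ s) ≡ true → u ≡ true → s ≡ false
nand-sound {true} {false} _ _ = refl

∨-sound : ∀ {a b} → a ∨ b ≡ true → a ≡ true ⊎ b ≡ true
∨-sound {true}  _ = inj₁ refl
∨-sound {false} h = inj₂ h

∨-introˡ : ∀ {a} b → a ≡ true → a ∨ b ≡ true
∨-introˡ b refl = refl

∨-introʳ : ∀ a {b} → b ≡ true → a ∨ b ≡ true
∨-introʳ a refl = ∨-zeroʳ a

_⇒ᵇ_ : Bool → Bool → Bool
a ⇒ᵇ b = not a ∨ b

⇒ᵇ-mp : ∀ {a b} → (a ⇒ᵇ b) ≡ true → a ≡ true → b ≡ true
⇒ᵇ-mp h refl = h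

does-sound : ∀ {P : Set} (d : Dec P) → does d ≡ true → P
does-sound (yes p) _ = p

∀ᵇ : (Bool → Bool) → Bool
∀ᵇ p = p false ∧ p true

∀ᵇ-sound : ∀ p → ∀ᵇ p ≡ true → ∀ b → p b ≡ true
∀ᵇ-sound p h false = ∧-conicalˡ (p false) (p true) h
∀ᵇ-sound p h true  = ∧-conicalʳ (p false) (p true) h

∃ᵇ : (Bool → Bool) → Bool
∃ᵇ p = p false ∨ p true

∃ᵇ-sound : ∀ p → ∃ᵇ p ≡ true → ∃[ b ] p b ≡ true
∃ᵇ-sound p h with p false in p0
... | true  = false , p0
... | false = true , h

∃ᵇ-false : ∀ p → ∃ᵇ p ≡ false → ∀ b → p b ≡ false
∃ᵇ-false p h false = ∨-conicalˡ (p false) (p true) h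
∃ᵇ-false p h true  = ∨-conicalʳ (p false) (p true) h

∀ᵇ-false : ∀ p → ∀ᵇ p ≡ false → ∃[ b ] p b ≡ false
∀ᵇ-false p h with p false in p0
... | false = false , p0
... | true  = true , h

all-sound : ∀ {A : Set} {p : A → Bool} {xs} → all p xs ≡ true → ∀ {x} → x ∈ xs → p x ≡ true
all-sound h (here refl)  = ∧-conicalˡ _ _ h
all-sound h (there x∈xs) = all-sound (∧-conicalʳ _ _ h) x∈xs

any-sound : ∀ {A : Set} {p : A → Bool} xs → any p xs ≡ true → ∃[ x ] p x ≡ true
any-sound {p = p} (x ∷ xs) h with p x in px
... | true  = x , px
... | false = any-sound xs h

bitVectors : ∀ n → List (Vec Bool n)
bitVectors zero    = [] ∷ []
bitVectors (suc n) = map (false ∷_) (bitVectors n) ++ map (true ∷_) (bitVectors n)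

∈-bitVectors : ∀ {n} (v : Vec Bool n) → v ∈ bitVectors n
∈-bitVectors []          = here refl
∈-bitVectors (false ∷ v) = ∈-++⁺ˡ (∈-map⁺ (false ∷_) (∈-bitVectors v))
∈-bitVectors (true ∷ v)  = ∈-++⁺ʳ _ (∈-map⁺ (true ∷_) (∈-bitVectors v))

bit : Bool → ℕ
bit true  = 1
bit false = 0

count : {A : Set} → (A → Bool) → List A → ℕ
count p []       = 0
count p (x ∷ xs) = bit (p x) + count p xs

bit-∨ : ∀ a b → bit (a ∨ b) ≤ bit a + bit b
bit-∨ true  b = s≤s z≤n
bit-∨ false b = ≤-refl

count-++ : ∀ {A : Set} (p : A → Bool) xs ys → count p (xs ++ ys) ≡ count p xs + count p ys
count-++ p []       ys = refl
count-++ p (x ∷ xs) ys = trans (cong (bit (p x) +_) (count-++ p xs ys)) (sym (+-assoc (bit (p x)) _ _))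

count-∨ : ∀ {A : Set} (p q : A → Bool) xs → count (λ x → p x ∨ q x) xs ≤ count p xs + count q xs
count-∨ p q []       = z≤n
count-∨ p q (x ∷ xs) = ≤-trans (+-mono-≤ (bit-∨ (p x) (q x)) (count-∨ p q xs))
                               (≤-reflexive (interchange (bit (p x)) (bit (q x)) (count p xs) (count q xs)))
  where
  interchange : ∀ a b c d → (a + b) + (c + d) ≡ (a + c) + (b + d)
  interchange = solve-∀

count-false : ∀ {A : Set} (xs : List A) → count (λ _ → false) xs ≡ 0
count-false []       = refl
count-false (_ ∷ xs) = count-false xs

count≢0⇒∃ : ∀ {A : Set} (p : A → Bool) xs → count p xs ≢ 0 → ∃[ x ] x ∈ xs × p x ≡ true
count≢0⇒∃ p []       c≢0 = ⊥-elim (c≢0 refl)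
count≢0⇒∃ p (x ∷ xs) c≢0 with p x in px
... | true  = x , here refl , px
... | false with count≢0⇒∃ p xs c≢0
...   | y , y∈xs , py = y , there y∈xs , py

another-member : ∀ {A : Set} (p : A → Bool) {xs} → Unique xs → count p xs ≢ 1 →
                 ∀ {v} → v ∈ xs → p v ≡ true → ∃[ w ] w ∈ xs × w ≢ v × p w ≡ true
another-member p {x ∷ xs} (x∉xs ∷ _) c≢1 (here refl) pv rewrite pv
  with count≢0⇒∃ p xs (λ c≡0 → c≢1 (cong suc c≡0))
... | w , w∈xs , pw = w , there w∈xs , (λ w≡x → All.lookup x∉xs w∈xs (sym w≡x)) , pw
another-member p {x ∷ xs} (x∉xs ∷ uniq) c≢1 (there v∈xs) pv with p x in px
... | true  = x , here refl , All.lookup x∉xs v∈xs , px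
... | false with another-member p uniq c≢1 v∈xs pv
...   | w , w∈xs , w≢v , pw = w , there w∈xs , w≢v , pw

module _ (G : Graph) (_≟_ : DecidableEquality (V G)) where

  isEndpointOf : Edge G → V G → Bool
  isEndpointOf (a , b) v = does (v ≟ a) ∨ does (v ≟ b)

  isEndpoint : List (Edge G) → V G → Bool
  isEndpoint K v = any (λ e → isEndpointOf e v) K

  endpoint⇒isEndpoint : ∀ {K v} → Endpoint G K v → isEndpoint K v ≡ true
  endpoint⇒isEndpoint {(a , b) ∷ K} (here (inj₁ refl)) = ∨-introˡ _ (∨-introˡ _ (dec-true (a ≟ a) refl))
  endpoint⇒isEndpoint {(a , b) ∷ K} (here (inj₂ refl)) =
    ∨-introˡ _ (∨-introʳ (does (b ≟ a)) (dec-true (b ≟ b) refl))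
  endpoint⇒isEndpoint {e ∷ K}       (there v∈K)        = ∨-introʳ _ (endpoint⇒isEndpoint v∈K)

  count-endpoints : ∀ vs K → All (λ e → count (isEndpointOf e) vs ≤ 1) K → count (isEndpoint K) vs ≤ length K
  count-endpoints vs []      []       = ≤-reflexive (count-false vs)
  count-endpoints vs (e ∷ K) (h ∷ hs) =
    ≤-trans (count-∨ (isEndpointOf e) (isEndpoint K) vs) (+-mono-≤ h (count-endpoints vs K hs))

weight : ∀ {A : Set} {k} → (A → ℕ) → Vec A k → ℕ
weight c v = Vec.sum (Vec.map c v)

withinBudget : ∀ {A : Set} → (A → ℕ) → List A → (k : ℕ) → ℕ → (Vec A k → ℕ → Bool) → Bool
withinBudget c xs zero    n p = p [] n
withinBudget c xs (suc k) n p =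
  all (λ x → if c x ≤ᵇ n then withinBudget c xs k (n ∸ c x) (λ v → p (x ∷ v)) else true) xs

budget-split : ∀ a b n → a + b ≤ n → a ≤ n × b ≤ n ∸ a
budget-split a b n a+b≤n = m+n≤o⇒m≤o a a+b≤n , m+n≤o⇒m≤o∸n b (subst (_≤ n) (+-comm a b) a+b≤n)

withinBudget-sound : ∀ {A : Set} {c : A → ℕ} {xs k n p} → (∀ x → x ∈ xs) → withinBudget c xs k n p ≡ true →
                     (v : Vec A k) → weight c v ≤ n → p v (n ∸ weight c v) ≡ true
withinBudget-sound complete h [] _ = h
withinBudget-sound {c = c} {k = suc k} {n} {p} complete h (x ∷ v) wt≤n
  with budget-split (c x) (weight c v) n wt≤n
... | cx≤n , wv≤rest = subst (λ m → p (x ∷ v) m ≡ true) (∸-+-assoc n (c x) (weight c v))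
                         (withinBudget-sound complete branch v wv≤rest)
  where
  branch : withinBudget c _ k (n ∸ c x) (λ w → p (x ∷ w)) ≡ true
  branch with c x ≤ᵇ n in le | all-sound h (complete x)
  ... | true  | hx = hx
  ... | false | _  = ⊥-elim (subst T le (≤⇒≤ᵇ cx≤n))

Square : Set → Set
Square A = Bool → Bool → A

square : {A : Set} → A → A → A → A → Square A
square a _ _ _ false false = a
square _ b _ _ true  false = b
square _ _ c _ false true  = c
square _ _ _ d true  true  = d

entries : {A : Set} → Square A → Vec A 4
entries s = s false false ∷ s true false ∷ s false true ∷ s true true ∷ []

fromEntries : {A : Set} → Vec A 4 → Square A
fromEntries (a ∷ b ∷ c ∷ d ∷ []) = square a b c d

Σ□ : {A : Set} → (A → ℕ) → Square A → ℕ
Σ□ c s = weight c (entries s)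

concat□ : {A : Set} → Square (List A) → List A
concat□ s = s false false ++ s true false ++ s false true ++ s true true

count-concat□ : ∀ {A : Set} (p : A → Bool) s → count p (concat□ s) ≡ Σ□ (count p) s
count-concat□ p s = begin
  count p (a ++ b ++ c ++ d)                           ≡⟨ count-++ p a _ ⟩
  count p a + count p (b ++ c ++ d)                    ≡⟨ cong (count p a +_) (count-++ p b _) ⟩
  count p a + (count p b + count p (c ++ d))           ≡⟨ cong (λ m → count p a + (count p b + m)) (count-++ p c d) ⟩
  count p a + (count p b + (count p c + count p d))    ≡⟨ cong (λ m → count p a + (count p b + (count p c + m)))
                                                               (sym (+-identityʳ _)) ⟩
  Σ□ (count p) s                                       ∎
  where
  open ≡-Reasoning
  a = s false false
  b = s true false
  c = s false true
  d = s true true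

Σ□-mono : ∀ {A B : Set} (f : A → ℕ) (g : B → ℕ) {s t} → (∀ x y → f (s x y) ≤ g (t x y)) → Σ□ f s ≤ Σ□ g t
Σ□-mono f g le =
  +-mono-≤ (le false false) (+-mono-≤ (le true false) (+-mono-≤ (le false true) (+-mono-≤ (le true true) ≤-refl)))

Σ□-cong : ∀ {A B : Set} (f : A → ℕ) (g : B → ℕ) {s t} → (∀ x y → f (s x y) ≡ g (t x y)) → Σ□ f s ≡ Σ□ g t
Σ□-cong f g eq =
  cong₂ _+_ (eq false false) (cong₂ _+_ (eq true false) (cong₂ _+_ (eq false true) (cong (_+ 0) (eq true true))))

Σ□-2+ : ∀ {A : Set} (f : A → ℕ) s → Σ□ (λ x → 2 + f x) s ≡ 8 + Σ□ f s
Σ□-2+ f s = lemma (f (s false false)) (f (s true false)) (f (s false true)) (f (s true true))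
  where
  lemma : ∀ a b c d → (2 + a) + ((2 + b) + ((2 + c) + ((2 + d) + 0))) ≡ 8 + (a + (b + (c + (d + 0))))
  lemma = solve-∀

∀□ : Square Bool → Bool
∀□ s = ∀ᵇ λ x → ∀ᵇ λ y → s x y

∃□ : Square Bool → Bool
∃□ s = ∃ᵇ λ x → ∃ᵇ λ y → s x y

∀□-sound : ∀ s → ∀□ s ≡ true → ∀ x y → s x y ≡ true
∀□-sound s h x y = ∀ᵇ-sound (s x) (∀ᵇ-sound (λ x → ∀ᵇ (s x)) h x) y

∃□-sound : ∀ s → ∃□ s ≡ true → ∃[ x ] ∃[ y ] s x y ≡ true
∃□-sound s h with ∃ᵇ-sound (λ x → ∃ᵇ (s x)) h
... | x , hx with ∃ᵇ-sound (s x) hx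
...   | y , hxy = x , y , hxy

∃□-false : ∀ s → ∃□ s ≡ false → ∀ x y → s x y ≡ false
∃□-false s h x y = ∃ᵇ-false (s x) (∃ᵇ-false (λ x → ∃ᵇ (s x)) h x) y

toggle : ∀ {r} → Fin r → Vec Bool r → Vec Bool r
toggle p w = updateAt w p not

toggle-involutive : ∀ {r} (p : Fin r) w → toggle p (toggle p w) ≡ w
toggle-involutive p w = trans (updateAt-updateAt-local p w (not-involutive _)) (updateAt-id p w)

toggle-≢ : ∀ {r} (p : Fin r) w → toggle p w ≢ w
toggle-≢ p w e = not-¬ refl (trans (sym (cong (λ u → lookup u p) e)) (lookup∘updateAt p w))

toggle-differs : ∀ {r} (p : Fin r) w → DifferPreciselyIn w (toggle p w) (suc (toℕ p))
toggle-differs p w q = at-p , elsewhere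
  where
  at-p : suc (toℕ q) ≡ suc (toℕ p) → lookup w q ≢ lookup (toggle p w) q
  at-p e with toℕ-injective (ℕ.suc-injective e)
  ... | refl = λ x≡ → not-¬ refl (trans x≡ (lookup∘updateAt p w))
  elsewhere : suc (toℕ q) ≢ suc (toℕ p) → lookup w q ≡ lookup (toggle p w) q
  elsewhere ne = sym (lookup∘updateAt′ q p (λ q≡p → ne (cong (suc ∘ toℕ) q≡p)) w)

differs⇒toggle : ∀ {r} {w w' : Vec Bool r} (p : Fin r) → DifferPreciselyIn w w' (suc (toℕ p)) → w' ≡ toggle p w
differs⇒toggle {w = w} {w'} p D = begin
  w'                             ≡⟨ sym (tabulate∘lookup w') ⟩
  tabulate (lookup w')           ≡⟨ tabulate-cong pointwise ⟩
  tabulate (lookup (toggle p w)) ≡⟨ tabulate∘lookup _ ⟩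
  toggle p w                     ∎
  where
  open ≡-Reasoning
  pointwise : ∀ q → lookup w' q ≡ lookup (toggle p w) q
  pointwise q with q Fin.≟ p
  ... | yes refl = trans (¬-not (λ e → proj₁ (D p) refl (sym e))) (sym (lookup∘updateAt p w))
  ... | no q≢p   = trans (sym (proj₂ (D q) (q≢p ∘ toℕ-injective ∘ ℕ.suc-injective)))
                         (sym (lookup∘updateAt′ q p q≢p w))

arc-straight : ∀ {r} (p : Fin r) w → BFArc (w , inject₁ p) (w , suc p)
arc-straight p w = cong suc (sym (toℕ-inject₁ p)) , inj₁ refl

arc-cross : ∀ {r} (p : Fin r) w → BFArc (w , inject₁ p) (toggle p w , suc p)
arc-cross p w = cong suc (sym (toℕ-inject₁ p)) , inj₂ (toggle-differs p w)

arc-cross⁻ : ∀ {r} (p : Fin r) w → BFArc (toggle p w , inject₁ p) (w , suc p)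
arc-cross⁻ p w = subst (λ u → BFArc (toggle p w , inject₁ p) (u , suc p)) (toggle-involutive p w)
                       (arc-cross p (toggle p w))

arc-target : ∀ {r} {w w' : Vec Bool r} {i p} → BFArc (w , i) (w' , suc p) → w' ≡ w ⊎ w' ≡ toggle p w
arc-target         (_ , inj₁ refl) = inj₁ refl
arc-target {p = p} (_ , inj₂ D)    = inj₂ (differs⇒toggle p D)

arc-source : ∀ {r} {w w' : Vec Bool r} {i p} → BFArc (w' , i) (w , suc p) → w' ≡ w ⊎ w' ≡ toggle p w
arc-source                 (_ , inj₁ refl) = inj₁ refl
arc-source {w' = w'} {p = p} (_ , inj₂ D)  =
  inj₂ (sym (trans (cong (toggle p) (differs⇒toggle p D)) (toggle-involutive p w')))

evenᵇ : ℕ → Bool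
evenᵇ zero    = true
evenᵇ (suc n) = not (evenᵇ n)

onEvenLevel : ∀ {r} → BFVertex r → Bool
onEvenLevel (_ , i) = evenᵇ (toℕ i)

adjacent-parity : ∀ {r} {u v : BFVertex r} → Adj (BF r) u v → bit (onEvenLevel u) + bit (onEvenLevel v) ≡ 1
adjacent-parity (inj₁ arc) = arc-parity arc
  where
  arc-parity : ∀ {r} {u v : BFVertex r} → BFArc u v → bit (onEvenLevel u) + bit (onEvenLevel v) ≡ 1
  arc-parity {u = _ , i} (level , _) rewrite level with evenᵇ (toℕ i)
  ... | true  = refl
  ... | false = refl
adjacent-parity {u = u} {v} (inj₂ arc) =
  trans (+-comm (bit (onEvenLevel u)) _) (adjacent-parity {u = v} (inj₁ arc))

Bits : Set
Bits = Vec Bool 4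

V₄ : Set
V₄ = BFVertex 4

_≟ᵥ_ : DecidableEquality V₄
_≟ᵥ_ = ×.≡-dec (VecP.≡-dec Bool._≟_) Fin._≟_

-- Levels l₀ … l₄, and bit positions i₁ … i₄ (position iⱼ holds bit j, as in DifferPreciselyIn).
pattern l₀ = zero
pattern l₁ = suc l₀
pattern l₂ = suc l₁
pattern l₃ = suc l₂
pattern l₄ = suc l₃

pattern i₁ = zero
pattern i₂ = suc i₁
pattern i₃ = suc i₂
pattern i₄ = suc i₃

distinct-on-level : ∀ {w w' : Bits} {l : Fin 5} → w' ≢ w → (w , l) ≢ (w' , l)
distinct-on-level w'≢w e = w'≢w (sym (cong proj₁ e))

neighbours₁ : Bits → List V₄
neighbours₁ w = (w , l₀) ∷ (toggle i₁ w , l₀) ∷ (w , l₂) ∷ (toggle i₂ w , l₂) ∷ []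

neighbours₃ : Bits → List V₄
neighbours₃ w = (w , l₄) ∷ (toggle i₄ w , l₄) ∷ (w , l₂) ∷ (toggle i₃ w , l₂) ∷ []

neighbours₁-complete : ∀ {w v} → Adj (BF 4) (w , l₁) v → v ∈ neighbours₁ w
neighbours₁-complete {v = _ , l₀} (inj₂ arc) with arc-source arc
... | inj₁ refl = here refl
... | inj₂ refl = there (here refl)
neighbours₁-complete {v = _ , l₂} (inj₁ arc) with arc-target arc
... | inj₁ refl = there (there (here refl))
... | inj₂ refl = there (there (there (here refl)))
neighbours₁-complete {v = _ , l₀} (inj₁ (() , _))
neighbours₁-complete {v = _ , l₁} (inj₁ (() , _))
neighbours₁-complete {v = _ , l₁} (inj₂ (() , _))
neighbours₁-complete {v = _ , l₂} (inj₂ (() , _))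
neighbours₁-complete {v = _ , l₃} (inj₁ (() , _))
neighbours₁-complete {v = _ , l₃} (inj₂ (() , _))
neighbours₁-complete {v = _ , l₄} (inj₁ (() , _))
neighbours₁-complete {v = _ , l₄} (inj₂ (() , _))

neighbours₃-complete : ∀ {w v} → Adj (BF 4) (w , l₃) v → v ∈ neighbours₃ w
neighbours₃-complete {v = _ , l₄} (inj₁ arc) with arc-target arc
... | inj₁ refl = here refl
... | inj₂ refl = there (here refl)
neighbours₃-complete {v = _ , l₂} (inj₂ arc) with arc-source arc
... | inj₁ refl = there (there (here refl))
... | inj₂ refl = there (there (there (here refl)))
neighbours₃-complete {v = _ , l₀} (inj₁ (() , _))
neighbours₃-complete {v = _ , l₀} (inj₂ (() , _))
neighbours₃-complete {v = _ , l₁} (inj₁ (() , _))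
neighbours₃-complete {v = _ , l₁} (inj₂ (() , _))
neighbours₃-complete {v = _ , l₂} (inj₁ (() , _))
neighbours₃-complete {v = _ , l₃} (inj₁ (() , _))
neighbours₃-complete {v = _ , l₃} (inj₂ (() , _))
neighbours₃-complete {v = _ , l₄} (inj₂ (() , _))

neighbours₁-adjacent : ∀ w → All (Adj (BF 4) (w , l₁)) (neighbours₁ w)
neighbours₁-adjacent w =
  inj₂ (arc-straight i₁ w) ∷ inj₂ (arc-cross⁻ i₁ w) ∷ inj₁ (arc-straight i₂ w) ∷ inj₁ (arc-cross i₂ w) ∷ []

neighbours₃-adjacent : ∀ w → All (Adj (BF 4) (w , l₃)) (neighbours₃ w)
neighbours₃-adjacent w =
  inj₁ (arc-straight i₄ w) ∷ inj₁ (arc-cross i₄ w) ∷ inj₂ (arc-straight i₃ w) ∷ inj₂ (arc-cross⁻ i₃ w) ∷ []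

neighbours₁-unique : ∀ w → Unique (neighbours₁ w)
neighbours₁-unique w = (distinct-on-level (toggle-≢ i₁ w) ∷ (λ ()) ∷ (λ ()) ∷ [])
                     ∷ ((λ ()) ∷ (λ ()) ∷ [])
                     ∷ (distinct-on-level (toggle-≢ i₂ w) ∷ [])
                     ∷ [] ∷ []

neighbours₃-unique : ∀ w → Unique (neighbours₃ w)
neighbours₃-unique w = (distinct-on-level (toggle-≢ i₄ w) ∷ (λ ()) ∷ (λ ()) ∷ [])
                     ∷ ((λ ()) ∷ (λ ()) ∷ [])
                     ∷ (distinct-on-level (toggle-≢ i₃ w) ∷ [])
                     ∷ [] ∷ []

record EvenSet : Set where
  field
    on₀ on₂ on₄ : Bits → Bool

open EvenSet

member : EvenSet → V₄ → Bool
member F (w , l₀) = on₀ F w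
member F (w , l₁) = false
member F (w , l₂) = on₂ F w
member F (w , l₃) = false
member F (w , l₄) = on₄ F w

IsEvenFort : EvenSet → Set
IsEvenFort F = (∀ w → count (member F) (neighbours₁ w) ≢ 1) × (∀ w → count (member F) (neighbours₃ w) ≢ 1)

member-on-odd-level : ∀ F {v} → onEvenLevel v ≡ false → member F v ≡ false
member-on-odd-level F {_ , l₁} _ = refl
member-on-odd-level F {_ , l₃} _ = refl
member-on-odd-level F {_ , l₀} ()
member-on-odd-level F {_ , l₂} ()
member-on-odd-level F {_ , l₄} ()

even-neighbour-not-member : ∀ F {u v} → onEvenLevel u ≡ true → Adj (BF 4) u v → member F v ≢ true
even-neighbour-not-member F {v = v} u-even u~v Fv = true≢false (trans (sym Fv) (member-on-odd-level F {v} v-odd))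
  where
  1+bit≡1 : ∀ b → 1 + bit b ≡ 1 → b ≡ false
  1+bit≡1 false _ = refl
  v-odd : onEvenLevel v ≡ false
  v-odd = 1+bit≡1 _ (subst (λ b → bit b + bit (onEvenLevel v) ≡ 1) u-even (adjacent-parity u~v))

evenFort⇒fort : ∀ {F} → IsEvenFort F → IsFort (BF 4) (λ v → member F v ≡ true)
evenFort⇒fort {F} (odd₁ , odd₃) {w , l₁} Fv u~v
  with another-member (member F) (neighbours₁-unique w) (odd₁ w) (neighbours₁-complete u~v) Fv
... | x , x∈ , x≢v , Fx = x , All.lookup (neighbours₁-adjacent w) x∈ , x≢v , Fx
evenFort⇒fort {F} (odd₁ , odd₃) {w , l₃} Fv u~v
  with another-member (member F) (neighbours₃-unique w) (odd₃ w) (neighbours₃-complete u~v) Fv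
... | x , x∈ , x≢v , Fx = x , All.lookup (neighbours₃-adjacent w) x∈ , x≢v , Fx
evenFort⇒fort {F} _ {_ , l₀} Fv u~v = ⊥-elim (even-neighbour-not-member F refl u~v Fv)
evenFort⇒fort {F} _ {_ , l₂} Fv u~v = ⊥-elim (even-neighbour-not-member F refl u~v Fv)
evenFort⇒fort {F} _ {_ , l₄} Fv u~v = ⊥-elim (even-neighbour-not-member F refl u~v Fv)

Avoids : EvenSet → (V₄ → Bool) → Set
Avoids F S = ∀ v → member F v ≡ true → S v ≡ false

avoids-levelwise : ∀ {F S} → (∀ w → on₀ F w ≡ true → S (w , l₀) ≡ false) →
                   (∀ w → on₂ F w ≡ true → S (w , l₂) ≡ false) →
                   (∀ w → on₄ F w ≡ true → S (w , l₄) ≡ false) → Avoids F S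
avoids-levelwise a₀ a₂ a₄ (w , l₀) = a₀ w
avoids-levelwise a₀ a₂ a₄ (w , l₂) = a₂ w
avoids-levelwise a₀ a₂ a₄ (w , l₄) = a₄ w
avoids-levelwise a₀ a₂ a₄ (w , l₁) ()
avoids-levelwise a₀ a₂ a₄ (w , l₃) ()

twice-≢1 : ∀ b → bit b + (bit b + 0) ≢ 1
twice-≢1 false ()
twice-≢1 true  ()

on-level₀ on-level₂ on-level₄ : (Bits → Bool) → EvenSet
on-level₀ g = record { on₀ = g ; on₂ = λ _ → false ; on₄ = λ _ → false }
on-level₂ g = record { on₀ = λ _ → false ; on₂ = g ; on₄ = λ _ → false }
on-level₄ g = record { on₀ = λ _ → false ; on₂ = λ _ → false ; on₄ = g }

-- An odd vertex has two neighbours on each adjacent even level, exchanged by a toggle; a set invariant under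
-- that toggle contains 0 or 2 of them.

invariant-≢1 : ∀ (g : Bits → Bool) (t : Bits → Bits) → (∀ w → g (t w) ≡ g w) →
               ∀ w → bit (g w) + (bit (g (t w)) + 0) ≢ 1
invariant-≢1 g t inv w = subst (λ b → bit (g w) + (bit b + 0) ≢ 1) (sym (inv w)) (twice-≢1 (g w))

on-level₀-fort : ∀ g → (∀ w → g (toggle i₁ w) ≡ g w) → IsEvenFort (on-level₀ g)
on-level₀-fort g inv = invariant-≢1 g (toggle i₁) inv , λ _ ()

on-level₂-fort : ∀ g → (∀ w → g (toggle i₂ w) ≡ g w) → (∀ w → g (toggle i₃ w) ≡ g w) → IsEvenFort (on-level₂ g)
on-level₂-fort g inv₂ inv₃ = invariant-≢1 g (toggle i₂) inv₂ , invariant-≢1 g (toggle i₃) inv₃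

on-level₄-fort : ∀ g → (∀ w → g (toggle i₄ w) ≡ g w) → IsEvenFort (on-level₄ g)
on-level₄-fort g inv = (λ _ ()) , invariant-≢1 g (toggle i₄) inv

_≟ᵇ_ : ∀ {n} → DecidableEquality (Vec Bool n)
_≟ᵇ_ = VecP.≡-dec Bool._≟_

level₀-pair : Bool → Bool → Bool → Bits → Bool
level₀-pair b2 b3 b4 (_ ∷ w) = does (w ≟ᵇ (b2 ∷ b3 ∷ b4 ∷ []))

level₄-pair : Bool → Bool → Bool → Bits → Bool
level₄-pair b1 b2 b3 (a ∷ b ∷ c ∷ _ ∷ []) = does ((a ∷ b ∷ c ∷ []) ≟ᵇ (b1 ∷ b2 ∷ b3 ∷ []))

level₂-quadrant : Bool → Bool → Bits → Bool
level₂-quadrant b1 b4 (a ∷ _ ∷ _ ∷ d ∷ []) = does ((a ∷ d ∷ []) ≟ᵇ (b1 ∷ b4 ∷ []))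

level₀-pair-fort : ∀ b2 b3 b4 → IsEvenFort (on-level₀ (level₀-pair b2 b3 b4))
level₀-pair-fort b2 b3 b4 = on-level₀-fort (level₀-pair b2 b3 b4) λ { (_ ∷ _) → refl }

level₄-pair-fort : ∀ b1 b2 b3 → IsEvenFort (on-level₄ (level₄-pair b1 b2 b3))
level₄-pair-fort b1 b2 b3 = on-level₄-fort (level₄-pair b1 b2 b3) λ { (_ ∷ _ ∷ _ ∷ _ ∷ []) → refl }

level₂-quadrant-fort : ∀ b1 b4 → IsEvenFort (on-level₂ (level₂-quadrant b1 b4))
level₂-quadrant-fort b1 b4 =
  on-level₂-fort (level₂-quadrant b1 b4) (λ { (_ ∷ _ ∷ _ ∷ _ ∷ []) → refl }) (λ { (_ ∷ _ ∷ _ ∷ _ ∷ []) → refl })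

rowGadget : Square (List V₄)
rowGadget b3 b4 = (false ∷ false ∷ b3 ∷ b4 ∷ [] , l₀) ∷ (true ∷ false ∷ b3 ∷ b4 ∷ [] , l₀)
                ∷ (false ∷ true ∷ b3 ∷ b4 ∷ [] , l₀) ∷ (true ∷ true ∷ b3 ∷ b4 ∷ [] , l₀) ∷ []

colGadget : Square (List V₄)
colGadget b1 b2 = (b1 ∷ b2 ∷ false ∷ false ∷ [] , l₄) ∷ (b1 ∷ b2 ∷ false ∷ true ∷ [] , l₄)
                ∷ (b1 ∷ b2 ∷ true ∷ false ∷ [] , l₄) ∷ (b1 ∷ b2 ∷ true ∷ true ∷ [] , l₄) ∷ []

quadrant : Square (List V₄)
quadrant b1 b4 = (b1 ∷ false ∷ false ∷ b4 ∷ [] , l₂) ∷ (b1 ∷ true ∷ false ∷ b4 ∷ [] , l₂)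
               ∷ (b1 ∷ false ∷ true ∷ b4 ∷ [] , l₂) ∷ (b1 ∷ true ∷ true ∷ b4 ∷ [] , l₂) ∷ []

evenVertices : List V₄
evenVertices = concat□ rowGadget ++ concat□ colGadget ++ concat□ quadrant

count-evenVertices : ∀ S → count S evenVertices ≡
                     Σ□ (count S) rowGadget + (Σ□ (count S) colGadget + Σ□ (count S) quadrant)
count-evenVertices S = begin
  count S evenVertices
    ≡⟨ count-++ S (concat□ rowGadget) (concat□ colGadget ++ concat□ quadrant) ⟩
  count S (concat□ rowGadget) + count S (concat□ colGadget ++ concat□ quadrant)
    ≡⟨ cong₂ _+_ (count-concat□ S rowGadget) (count-++ S (concat□ colGadget) (concat□ quadrant)) ⟩
  Σ□ (count S) rowGadget + (count S (concat□ colGadget) + count S (concat□ quadrant))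
    ≡⟨ cong (Σ□ (count S) rowGadget +_) (cong₂ _+_ (count-concat□ S colGadget) (count-concat□ S quadrant)) ⟩
  Σ□ (count S) rowGadget + (Σ□ (count S) colGadget + Σ□ (count S) quadrant) ∎
  where open ≡-Reasoning

evenVertices-enumerate : ∀ v → count (λ u → does (u ≟ᵥ v)) evenVertices ≡ bit (onEvenLevel v)
evenVertices-enumerate v@(w , i) =
  ℕ.≡ᵇ⇒≡ _ _ (subst T (sym (all-sound {p = enumerated} check listed)) tt)
  where
  listed = ∈-cartesianProduct⁺ (∈-bitVectors w) (∈-allFin i)
  enumerated : V₄ → Bool
  enumerated v = count (λ u → does (u ≟ᵥ v)) evenVertices ≡ᵇ bit (onEvenLevel v)
  check : all enumerated (cartesianProduct (bitVectors 4) (allFin 5)) ≡ true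
  check = refl

edge-meets-evenVertices-once : ∀ {a b} → Adj (BF 4) a b → count (isEndpointOf (BF 4) _≟ᵥ_ (a , b)) evenVertices ≤ 1
edge-meets-evenVertices-once {a} {b} a~b = begin
  count (isEndpointOf (BF 4) _≟ᵥ_ (a , b)) evenVertices
    ≤⟨ count-∨ (λ u → does (u ≟ᵥ a)) (λ u → does (u ≟ᵥ b)) evenVertices ⟩
  count (λ u → does (u ≟ᵥ a)) evenVertices + count (λ u → does (u ≟ᵥ b)) evenVertices
    ≡⟨ cong₂ _+_ (evenVertices-enumerate a) (evenVertices-enumerate b) ⟩
  bit (onEvenLevel a) + bit (onEvenLevel b)
    ≡⟨ adjacent-parity a~b ⟩
  1 ∎
  where open ℕ.≤-Reasoning

-- For an odd vertex whose outer pair is labelled l, the fort meets that pair exactly once if l holds and not at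
-- all otherwise; pairRule l x y is then what its two level-2 neighbours x, y need for the count to avoid 1.
pairRule : Bool → Bool → Bool → Bool
pairRule true  x y = x ∨ y
pairRule false x y = not (x xor y)

pairRule-comm : ∀ l x y → pairRule l x y ≡ pairRule l y x
pairRule-comm true  x y = ∨-comm x y
pairRule-comm false x y = cong not (xor-comm x y)

-- S marks the hit vertices of a quadrant (indexed by bits 2, 3), U the candidate fort vertices, and r, c the
-- labels of the pairs above its rows (bit 3) and columns (bit 2).
locallyValid : (S U : Square Bool) (r c : Bool → Bool) → Bool
locallyValid S U r c = ∀□ (λ x y → not (U x y ∧ S x y))
                     ∧ (∀ᵇ (λ b3 → pairRule (r b3) (U false b3) (U true b3))
                     ∧  ∀ᵇ (λ b2 → pairRule (c b2) (U b2 false) (U b2 true)))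

record LocalSolution (S : Square Bool) (r c : Bool → Bool) : Set where
  field
    fortPart : Square Bool
    avoids   : ∀ x y → fortPart x y ≡ true → S x y ≡ false
    rowRule  : ∀ b3 → pairRule (r b3) (fortPart false b3) (fortPart true b3) ≡ true
    colRule  : ∀ b2 → pairRule (c b2) (fortPart b2 false) (fortPart b2 true) ≡ true

locallyValid-sound : ∀ S U r c → locallyValid S U r c ≡ true → LocalSolution S r c
locallyValid-sound S U r c valid = record
  { fortPart = U
  ; avoids   = λ x y → nand-sound (∀□-sound disjoint (∧-conicalˡ (∀□ disjoint) (rows ∧ cols) valid) x y)
  ; rowRule  = ∀ᵇ-sound rowCondition (∧-conicalˡ rows cols (∧-conicalʳ (∀□ disjoint) (rows ∧ cols) valid))
  ; colRule  = ∀ᵇ-sound colCondition (∧-conicalʳ rows cols (∧-conicalʳ (∀□ disjoint) (rows ∧ cols) valid))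
  }
  where
  disjoint = λ x y → not (U x y ∧ S x y)
  rowCondition = λ b3 → pairRule (r b3) (U false b3) (U true b3)
  colCondition = λ b2 → pairRule (c b2) (U b2 false) (U b2 true)
  rows = ∀ᵇ rowCondition
  cols = ∀ᵇ colCondition

allSquares : List (Square Bool)
allSquares = map fromEntries (bitVectors 4)

hasLocalSolution : Square Bool → (Bool → Bool) → (Bool → Bool) → Bool
hasLocalSolution S r c = any (λ U → locallyValid S U r c) allSquares

-- A pattern is named by its values at (b2, b3) = 00, 10, 01, 11; the four singletons are merged into one class.
data Class : Set where
  single c1100 c1010 c1001 c0110 c0101 c0011 c1110 c1101 c1011 c0111 c1111 : Class

allClasses : List Class
allClasses = single ∷ c1100 ∷ c1010 ∷ c1001 ∷ c0110 ∷ c0101 ∷ c0011 ∷ c1110 ∷ c1101 ∷ c1011 ∷ c0111 ∷ c1111 ∷ []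

∈-allClasses : ∀ k → k ∈ allClasses
∈-allClasses single = here refl
∈-allClasses c1100  = there (here refl)
∈-allClasses c1010  = there (there (here refl))
∈-allClasses c1001  = there (there (there (here refl)))
∈-allClasses c0110  = there (there (there (there (here refl))))
∈-allClasses c0101  = there (there (there (there (there (here refl)))))
∈-allClasses c0011  = there (there (there (there (there (there (here refl))))))
∈-allClasses c1110  = there (there (there (there (there (there (there (here refl)))))))
∈-allClasses c1101  = there (there (there (there (there (there (there (there (here refl))))))))
∈-allClasses c1011  = there (there (there (there (there (there (there (there (there (here refl)))))))))
∈-allClasses c0111  = there (there (there (there (there (there (there (there (there (there (here refl))))))))))
∈-allClasses c1111  = there (there (there (there (there (there (there (there (there (there (there (here refl)))))))))))

cost : Class → ℕ
cost single = 1
cost c1100  = 2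
cost c1010  = 2
cost c1001  = 2
cost c0110  = 2
cost c0101  = 2
cost c0011  = 2
cost c1110  = 3
cost c1101  = 3
cost c1011  = 3
cost c0111  = 3
cost c1111  = 4

classify : Bool → Bool → Bool → Bool → Class
classify false false true  true  = c0011
classify false true  false true  = c0101
classify false true  true  false = c0110
classify false true  true  true  = c0111
classify true  false false true  = c1001
classify true  false true  false = c1010
classify true  false true  true  = c1011
classify true  true  false false = c1100
classify true  true  false true  = c1101
classify true  true  true  false = c1110
classify true  true  true  true  = c1111
classify _     _     _     _     = single

classOf : Square Bool → Class
classOf s = classify (s false false) (s true false) (s false true) (s true true)

cost-classify : ∀ a b c d → (a ∨ c) ∨ (b ∨ d) ≡ true →
                cost (classify a b c d) ≡ bit a + (bit b + (bit c + (bit d + 0)))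
cost-classify false false false false ()
cost-classify false false false true  _ = refl
cost-classify false false true  false _ = refl
cost-classify false false true  true  _ = refl
cost-classify false true  false false _ = refl
cost-classify false true  false true  _ = refl
cost-classify false true  true  false _ = refl
cost-classify false true  true  true  _ = refl
cost-classify true  false false false _ = refl
cost-classify true  false false true  _ = refl
cost-classify true  false true  false _ = refl
cost-classify true  false true  true  _ = refl
cost-classify true  true  false false _ = refl
cost-classify true  true  false true  _ = refl
cost-classify true  true  true  false _ = refl
cost-classify true  true  true  true  _ = refl

cost-classOf : ∀ s → ∃□ s ≡ true → cost (classOf s) ≡ Σ□ bit s
cost-classOf s = cost-classify (s false false) (s true false) (s false true) (s true true)

-- feasibilityTable k (r false) (r true) (c false) (c true) holds when every pattern of class k has a local
-- solution with row labels r and column labels c; the table was computed by exhaustive search.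
feasibilityTable : Class → Square (Square Bool)
feasibilityTable single = square (square true false false true) (square false true true true)
                                 (square false true true true) (square true true true true)
feasibilityTable c1100  = square (square true false false true) (square false false false false)
                                 (square false true true true) (square false false false false)
feasibilityTable c1010  = square (square true false false false) (square false false true false)
                                 (square false false true false) (square true false true false)
feasibilityTable c1001  = square (square true false false false) (square false false true false)
                                 (square false true false false) (square false false false true)
feasibilityTable c0110  = square (square true false false false) (square false true false false)
                                 (square false false true false) (square false false false true)
feasibilityTable c0101  = square (square true false false false) (square false true false false)
                                 (square false true false false) (square true true false false)
feasibilityTable c0011  = square (square true false false true) (square false true true true)
                                 (square false false false false) (square false false false false)
feasibilityTable c1110  = square (square true false false false) (square false false false false)
                                 (square false false true false) (square false false false false)
feasibilityTable c1101  = square (square true false false false) (square false false false false)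
                                 (square false true false false) (square false false false false)
feasibilityTable c1011  = square (square true false false false) (square false false true false)
                                 (square false false false false) (square false false false false)
feasibilityTable c0111  = square (square true false false false) (square false true false false)
                                 (square false false false false) (square false false false false)
feasibilityTable c1111  = square (square true false false false) (square false false false false)
                                 (square false false false false) (square false false false false)

feasible : Class → (Bool → Bool) → (Bool → Bool) → Bool
feasible k r c = feasibilityTable k (r false) (r true) (c false) (c true)

feasibilityTable-correct : Vec Bool 4 → Vec Bool 4 → Bool
feasibilityTable-correct (s₀₀ ∷ s₁₀ ∷ s₀₁ ∷ s₁₁ ∷ []) (r₀ ∷ r₁ ∷ c₀ ∷ c₁ ∷ []) =
  ∃□ S ⇒ᵇ (feasible (classOf S) r c ⇒ᵇ hasLocalSolution S r c)
  where
  S = square s₀₀ s₁₀ s₀₁ s₁₁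
  r = λ x → if x then r₁ else r₀
  c = λ x → if x then c₁ else c₀

feasibilityTable-checked : all (λ s → all (feasibilityTable-correct s) (bitVectors 4)) (bitVectors 4) ≡ true
feasibilityTable-checked = refl

feasible-sound : ∀ S r c → ∃□ S ≡ true → feasible (classOf S) r c ≡ true → LocalSolution S r c
feasible-sound S r c nonempty isFeasible
  with any-sound {p = λ U → locallyValid S U r c} allSquares (⇒ᵇ-mp (⇒ᵇ-mp correct nonempty) isFeasible)
  where
  correct : feasibilityTable-correct (entries S) (r false ∷ r true ∷ c false ∷ c true ∷ []) ≡ true
  correct = all-sound {p = feasibilityTable-correct (entries S)}
              (all-sound {p = λ s → all (feasibilityTable-correct s) (bitVectors 4)} feasibilityTable-checked
                         (∈-bitVectors (entries S)))
              (∈-bitVectors (r false ∷ r true ∷ c false ∷ c true ∷ []))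
... | U , valid = locallyValid-sound S U r c valid

record Labelling : Set where
  constructor labelling
  field
    rowLabel colLabel : Square Bool

open Labelling

-- q gives the class of each quadrant (indexed by bits 1, 4), e marks the gadgets that contain a fully hit pair.
admissible : Square Class → Labelling → Labelling → Bool
admissible q e L =
  (∃□ (rowLabel L) ∨ ∃□ (colLabel L))
  ∧ ((∀□ (λ x y → not (rowLabel L x y ∧ rowLabel e x y)) ∧ ∀□ (λ x y → not (colLabel L x y ∧ colLabel e x y)))
  ∧ ∀□ (λ b1 b4 → feasible (q b1 b4) (λ b3 → rowLabel L b3 b4) (λ b2 → colLabel L b1 b2)))

record Admissible (q : Square Class) (e L : Labelling) : Set where
  field
    labelled       : (∃[ b3 ] ∃[ b4 ] rowLabel L b3 b4 ≡ true) ⊎ (∃[ b1 ] ∃[ b2 ] colLabel L b1 b2 ≡ true)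
    rows-avoid     : ∀ b3 b4 → rowLabel L b3 b4 ∧ rowLabel e b3 b4 ≡ false
    cols-avoid     : ∀ b1 b2 → colLabel L b1 b2 ∧ colLabel e b1 b2 ≡ false
    quadrants-feasible : ∀ b1 b4 → feasible (q b1 b4) (λ b3 → rowLabel L b3 b4) (λ b2 → colLabel L b1 b2) ≡ true

admissible-sound : ∀ q e L → admissible q e L ≡ true → Admissible q e L
admissible-sound q e L h = record
  { labelled           = Sum.map (∃□-sound (rowLabel L)) (∃□-sound (colLabel L)) (∨-sound (∧-conicalˡ _ _ h))
  ; rows-avoid         = λ x y → not-true (∀□-sound rowsAvoid (∧-conicalˡ (∀□ rowsAvoid) _ avoidance) x y)
  ; cols-avoid         = λ x y → not-true (∀□-sound colsAvoid (∧-conicalʳ (∀□ rowsAvoid) _ avoidance) x y)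
  ; quadrants-feasible = ∀□-sound feasibleAt (∧-conicalʳ avoidanceᵇ _ rest)
  }
  where
  rowsAvoid  = λ x y → not (rowLabel L x y ∧ rowLabel e x y)
  colsAvoid  = λ x y → not (colLabel L x y ∧ colLabel e x y)
  feasibleAt = λ b1 b4 → feasible (q b1 b4) (λ b3 → rowLabel L b3 b4) (λ b2 → colLabel L b1 b2)
  avoidanceᵇ = ∀□ rowsAvoid ∧ ∀□ colsAvoid
  rest       = ∧-conicalʳ (∃□ (rowLabel L) ∨ ∃□ (colLabel L)) (avoidanceᵇ ∧ ∀□ feasibleAt) h
  avoidance  = ∧-conicalˡ avoidanceᵇ (∀□ feasibleAt) rest

-- A family of labellings, found by computer search, that covers every configuration within budget.
candidates : List Labelling
candidates =
    labelling (square false false false false) (square false true false true)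
  ∷ labelling (square false false false false) (square true false true false)
  ∷ labelling (square false false true true) (square false false false false)
  ∷ labelling (square true true false false) (square false false false false)
  ∷ labelling (square false false true true) (square false true false true)
  ∷ labelling (square true true false false) (square false true false true)
  ∷ labelling (square false false true true) (square true false true false)
  ∷ labelling (square true true false false) (square true false true false)
  ∷ labelling (square true false true false) (square true true false false)
  ∷ labelling (square true false true false) (square true false false true)
  ∷ labelling (square true false true false) (square false true true false)
  ∷ labelling (square true false true false) (square false false true true)
  ∷ labelling (square true false false true) (square true true false false)
  ∷ labelling (square true false false true) (square true false false true)
  ∷ labelling (square true false false true) (square false true true false)
  ∷ labelling (square true false false true) (square false false true true)
  ∷ labelling (square false true true false) (square true true false false)
  ∷ labelling (square false true true false) (square true false false true)
  ∷ labelling (square false true true false) (square false true true false)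
  ∷ labelling (square false true true false) (square false false true true)
  ∷ labelling (square false true false true) (square true true false false)
  ∷ labelling (square false true false true) (square true false false true)
  ∷ labelling (square false true false true) (square false true true false)
  ∷ labelling (square false true false true) (square false false true true)
  ∷ labelling (square true true true true) (square false true false true)
  ∷ labelling (square false false true true) (square true true true true)
  ∷ labelling (square true true false false) (square true true true true)
  ∷ labelling (square true true true true) (square true false true false)
  ∷ labelling (square true true true true) (square true true true true)
  ∷ []

bools : List Bool
bools = false ∷ true ∷ []

∈-bools : ∀ b → b ∈ bools
∈-bools false = here refl
∈-bools true  = there (here refl)

labellingExists : Square Class → Labelling → Bool
labellingExists q e = any (admissible q e) candidates

searchColumns : Vec Class 4 → Vec Bool 4 → Vec Bool 4 → ℕ → Bool
searchColumns qv rv cv _ = labellingExists (fromEntries qv) (labelling (fromEntries rv) (fromEntries cv))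

searchRows : Vec Class 4 → Vec Bool 4 → ℕ → Bool
searchRows qv rv m = withinBudget bit bools 4 m (searchColumns qv rv)

searchClasses : Vec Class 4 → ℕ → Bool
searchClasses qv m = withinBudget bit bools 4 m (searchRows qv)

-- The budget 8 = 24 − 16 is what remains after one hit vertex in each of the 16 outer pairs.
searchSucceeds : withinBudget cost allClasses 4 8 searchClasses ≡ true
searchSucceeds = refl

admissible-labelling : ∀ q e → Σ□ cost q + (Σ□ bit (rowLabel e) + Σ□ bit (colLabel e)) ≤ 8 →
                       ∃[ L ] Admissible q e L
admissible-labelling q e fits = proj₁ found , admissible-sound q e (proj₁ found) (proj₂ found)
  where
  qv = entries q
  rv = entries (rowLabel e)
  cv = entries (colLabel e)
  split₁ = budget-split (Σ□ cost q) _ 8 fits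
  split₂ = budget-split (Σ□ bit (rowLabel e)) (Σ□ bit (colLabel e)) _ (proj₂ split₁)
  classesOk : searchClasses qv (8 ∸ Σ□ cost q) ≡ true
  classesOk = withinBudget-sound {c = cost} {p = searchClasses} ∈-allClasses searchSucceeds qv (proj₁ split₁)
  rowsOk : searchRows qv rv ((8 ∸ Σ□ cost q) ∸ Σ□ bit (rowLabel e)) ≡ true
  rowsOk = withinBudget-sound {c = bit} {p = searchRows qv} ∈-bools classesOk rv (proj₁ split₂)
  colsOk : labellingExists (fromEntries qv) (labelling (fromEntries rv) (fromEntries cv)) ≡ true
  colsOk = withinBudget-sound {c = bit} {p = searchColumns qv rv} ∈-bools rowsOk cv (proj₂ split₂)
  found = any-sound {p = admissible (fromEntries qv) (labelling (fromEntries rv) (fromEntries cv))} candidates colsOk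

hitPattern : (V₄ → Bool) → Bool → Bool → Square Bool
hitPattern S b1 b4 b2 b3 = S (b1 ∷ b2 ∷ b3 ∷ b4 ∷ [] , l₂)

rowExcess : (V₄ → Bool) → Square Bool
rowExcess S b3 b4 = ∃ᵇ λ b2 → ∀ᵇ λ b1 → S (b1 ∷ b2 ∷ b3 ∷ b4 ∷ [] , l₀)

colExcess : (V₄ → Bool) → Square Bool
colExcess S b1 b2 = ∃ᵇ λ b3 → ∀ᵇ λ b4 → S (b1 ∷ b2 ∷ b3 ∷ b4 ∷ [] , l₄)

excess : (V₄ → Bool) → Labelling
excess S = labelling (rowExcess S) (colExcess S)

∧-∃ᵇ-false : ∀ l p → l ∧ ∃ᵇ p ≡ false → ∀ b → l ∧ p b ≡ false
∧-∃ᵇ-false l p h = ∃ᵇ-false (λ b → l ∧ p b) (trans (sym (∧-distribˡ-∨ l (p false) (p true))) h)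

∧-∀ᵇ-oriented : ∀ l (s : Bool → Bool) b → l ∧ ∀ᵇ s ≡ false → l ∧ (s b ∧ s (not b)) ≡ false
∧-∀ᵇ-oriented l s false h = h
∧-∀ᵇ-oriented l s true  h = trans (cong (l ∧_) (∧-comm (s true) (s false))) h

pairRule-oriented : ∀ l (s : Bool → Bool) b → pairRule l (s false) (s true) ≡ true →
                    pairRule l (s b) (s (not b)) ≡ true
pairRule-oriented l s false h = h
pairRule-oriented l s true  h = trans (pairRule-comm l (s true) (s false)) h

-- Counts the fort neighbours of an odd vertex whose outer pair a, b lies in a gadget labelled l.
fort-count-≢1 : ∀ l a b x y → pairRule l x y ≡ true → l ∧ (a ∧ b) ≡ false →
                bit (l ∧ not a) + (bit (l ∧ not b) + (bit x + (bit y + 0))) ≢ 1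
fort-count-≢1 false _     _     false false _  _ ()
fort-count-≢1 false _     _     true  true  _  _ ()
fort-count-≢1 false _     _     false true  () _
fort-count-≢1 false _     _     true  false () _
fort-count-≢1 true  false false _     _     _  _ ()
fort-count-≢1 true  false true  true  _     _  _ ()
fort-count-≢1 true  false true  false true  _  _ ()
fort-count-≢1 true  false true  false false () _
fort-count-≢1 true  true  false true  _     _  _ ()
fort-count-≢1 true  true  false false true  _  _ ()
fort-count-≢1 true  true  false false false () _
fort-count-≢1 true  true  true  _     _     _  ()

module Model (S : V₄ → Bool) (L : Labelling)
  (solution : ∀ b1 b4 → LocalSolution (hitPattern S b1 b4) (λ b3 → rowLabel L b3 b4) (λ b2 → colLabel L b1 b2))
  (rows-avoid : ∀ b3 b4 → rowLabel L b3 b4 ∧ rowExcess S b3 b4 ≡ false)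
  (cols-avoid : ∀ b1 b2 → colLabel L b1 b2 ∧ colExcess S b1 b2 ≡ false)
  where

  open LocalSolution

  fort : EvenSet
  fort = record
    { on₀ = λ { (b1 ∷ b2 ∷ b3 ∷ b4 ∷ []) → rowLabel L b3 b4 ∧ not (S (b1 ∷ b2 ∷ b3 ∷ b4 ∷ [] , l₀)) }
    ; on₂ = λ { (b1 ∷ b2 ∷ b3 ∷ b4 ∷ []) → fortPart (solution b1 b4) b2 b3 }
    ; on₄ = λ { (b1 ∷ b2 ∷ b3 ∷ b4 ∷ []) → colLabel L b1 b2 ∧ not (S (b1 ∷ b2 ∷ b3 ∷ b4 ∷ [] , l₄)) }
    }

  isFort : IsEvenFort fort
  isFort = odd₁ , odd₃
    where
    odd₁ : ∀ w → count (member fort) (neighbours₁ w) ≢ 1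
    odd₁ (b1 ∷ b2 ∷ b3 ∷ b4 ∷ []) =
      fort-count-≢1 l (S (b1 ∷ b2 ∷ b3 ∷ b4 ∷ [] , l₀)) (S (not b1 ∷ b2 ∷ b3 ∷ b4 ∷ [] , l₀))
                      (U b2 b3) (U (not b2) b3)
        (pairRule-oriented l (λ x → U x b3) b2 (rowRule (solution b1 b4) b3))
        (∧-∀ᵇ-oriented l outer b1 (∧-∃ᵇ-false l (λ x → ∀ᵇ (pair x)) (rows-avoid b3 b4) b2))
      where
      l = rowLabel L b3 b4
      U = fortPart (solution b1 b4)
      pair : Bool → Bool → Bool
      pair x y = S (y ∷ x ∷ b3 ∷ b4 ∷ [] , l₀)
      outer = pair b2
    odd₃ : ∀ w → count (member fort) (neighbours₃ w) ≢ 1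
    odd₃ (b1 ∷ b2 ∷ b3 ∷ b4 ∷ []) =
      fort-count-≢1 l (S (b1 ∷ b2 ∷ b3 ∷ b4 ∷ [] , l₄)) (S (b1 ∷ b2 ∷ b3 ∷ not b4 ∷ [] , l₄))
                      (U b2 b3) (U b2 (not b3))
        (pairRule-oriented l (U b2) b3 (colRule (solution b1 b4) b2))
        (∧-∀ᵇ-oriented l outer b4 (∧-∃ᵇ-false l (λ x → ∀ᵇ (pair x)) (cols-avoid b1 b2) b3))
      where
      l = colLabel L b1 b2
      U = fortPart (solution b1 b4)
      pair : Bool → Bool → Bool
      pair x y = S (b1 ∷ b2 ∷ x ∷ y ∷ [] , l₄)
      outer = pair b3

  fort-avoids : Avoids fort S
  fort-avoids = avoids-levelwise
    (λ { (_ ∷ _ ∷ _ ∷ _ ∷ []) h → not-true (∧-conicalʳ _ _ h) })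
    (λ { (b1 ∷ b2 ∷ b3 ∷ b4 ∷ []) h → avoids (solution b1 b4) b2 b3 h })
    (λ { (_ ∷ _ ∷ _ ∷ _ ∷ []) h → not-true (∧-conicalʳ _ _ h) })

  -- A labelled gadget has no fully hit pair, so the fort keeps a vertex of it.
  fort-nonempty : (∃[ b3 ] ∃[ b4 ] rowLabel L b3 b4 ≡ true) ⊎ (∃[ b1 ] ∃[ b2 ] colLabel L b1 b2 ≡ true) →
                  ∃[ v ] member fort v ≡ true
  fort-nonempty (inj₁ (b3 , b4 , labelled)) =
    (proj₁ unhit ∷ false ∷ b3 ∷ b4 ∷ [] , l₀) , cong₂ (λ l s → l ∧ not s) labelled (proj₂ unhit)
    where
    noExcess = subst (λ l → l ∧ rowExcess S b3 b4 ≡ false) labelled (rows-avoid b3 b4)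
    unhit = ∀ᵇ-false (λ b1 → S (b1 ∷ false ∷ b3 ∷ b4 ∷ [] , l₀))
                     (∃ᵇ-false (λ b2 → ∀ᵇ λ b1 → S (b1 ∷ b2 ∷ b3 ∷ b4 ∷ [] , l₀)) noExcess false)
  fort-nonempty (inj₂ (b1 , b2 , labelled)) =
    (b1 ∷ b2 ∷ false ∷ proj₁ unhit ∷ [] , l₄) , cong₂ (λ l s → l ∧ not s) labelled (proj₂ unhit)
    where
    noExcess = subst (λ l → l ∧ colExcess S b1 b2 ≡ false) labelled (cols-avoid b1 b2)
    unhit = ∀ᵇ-false (λ b4 → S (b1 ∷ b2 ∷ false ∷ b4 ∷ [] , l₄))
                     (∃ᵇ-false (λ b3 → ∀ᵇ λ b4 → S (b1 ∷ b2 ∷ b3 ∷ b4 ∷ [] , l₄)) noExcess false)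

pair-count : ∀ a b → a ∨ b ≡ true → 1 + bit (a ∧ b) ≤ bit a + bit b
pair-count true  true  _ = ≤-refl
pair-count true  false _ = ≤-refl
pair-count false true  _ = ≤-refl

gadget-count : ∀ a b c d → a ∨ b ≡ true → c ∨ d ≡ true →
               2 + bit ((a ∧ b) ∨ (c ∧ d)) ≤ bit a + (bit b + (bit c + (bit d + 0)))
gadget-count a b c d ab cd = begin
  2 + bit ((a ∧ b) ∨ (c ∧ d))               ≤⟨ +-monoʳ-≤ 2 (bit-∨ (a ∧ b) (c ∧ d)) ⟩
  2 + (bit (a ∧ b) + bit (c ∧ d))           ≡⟨ regroup (bit (a ∧ b)) (bit (c ∧ d)) ⟩
  (1 + bit (a ∧ b)) + (1 + bit (c ∧ d))     ≤⟨ +-mono-≤ (pair-count a b ab) (pair-count c d cd) ⟩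
  (bit a + bit b) + (bit c + bit d)         ≡⟨ reassociate (bit a) (bit b) (bit c) (bit d) ⟩
  bit a + (bit b + (bit c + (bit d + 0)))   ∎
  where
  open ℕ.≤-Reasoning
  regroup : ∀ x y → 2 + (x + y) ≡ (1 + x) + (1 + y)
  regroup = solve-∀
  reassociate : ∀ a b c d → (a + b) + (c + d) ≡ a + (b + (c + (d + 0)))
  reassociate = solve-∀

remaining-budget : ∀ r c q → (8 + r) + ((8 + c) + q) ≤ 24 → q + (r + c) ≤ 8
remaining-budget r c q h = +-cancelˡ-≤ 16 _ _ (subst (_≤ 24) (regroup r c q) h)
  where
  regroup : ∀ r c q → (8 + r) + ((8 + c) + q) ≡ 16 + (q + (r + c))
  regroup = solve-∀

module ShortForcingSet (K : List (Edge (BF 4))) (edges : All (λ e → Adj (BF 4) (proj₁ e) (proj₂ e)) K)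
                       (closed : ∀ v → InClosure (BF 4) (Endpoint (BF 4) K) v) where

  hit : V₄ → Bool
  hit = isEndpoint (BF 4) _≟ᵥ_ K

  no-avoiding-fort : ∀ F → IsEvenFort F → ∀ v → member F v ≡ true → ¬ Avoids F hit
  no-avoiding-fort F fort v Fv avoids = forcing-set-meets-fort closed (evenFort⇒fort {F} fort) {v} Fv
    λ {u} endpoint Fu → true≢false (trans (sym (endpoint⇒isEndpoint (BF 4) _≟ᵥ_ endpoint)) (avoids u Fu))

  level₀-pair-hit : ∀ b2 b3 b4 → ∃ᵇ (λ b1 → hit (b1 ∷ b2 ∷ b3 ∷ b4 ∷ [] , l₀)) ≡ true
  level₀-pair-hit b2 b3 b4 with ∃ᵇ (λ b1 → hit (b1 ∷ b2 ∷ b3 ∷ b4 ∷ [] , l₀)) in unhit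
  ... | true  = refl
  ... | false = ⊥-elim (no-avoiding-fort (on-level₀ (level₀-pair b2 b3 b4)) (level₀-pair-fort b2 b3 b4)
                         (false ∷ b2 ∷ b3 ∷ b4 ∷ [] , l₀) (dec-true ((b2 ∷ b3 ∷ b4 ∷ []) ≟ᵇ _) refl)
                         (avoids-levelwise avoid₀ (λ _ ()) (λ _ ())))
    where
    avoid₀ : ∀ w → level₀-pair b2 b3 b4 w ≡ true → hit (w , l₀) ≡ false
    avoid₀ (b1 ∷ w) inPair with does-sound (w ≟ᵇ (b2 ∷ b3 ∷ b4 ∷ [])) inPair
    ... | refl = ∃ᵇ-false (λ b1 → hit (b1 ∷ b2 ∷ b3 ∷ b4 ∷ [] , l₀)) unhit b1

  level₄-pair-hit : ∀ b1 b2 b3 → ∃ᵇ (λ b4 → hit (b1 ∷ b2 ∷ b3 ∷ b4 ∷ [] , l₄)) ≡ true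
  level₄-pair-hit b1 b2 b3 with ∃ᵇ (λ b4 → hit (b1 ∷ b2 ∷ b3 ∷ b4 ∷ [] , l₄)) in unhit
  ... | true  = refl
  ... | false = ⊥-elim (no-avoiding-fort (on-level₄ (level₄-pair b1 b2 b3)) (level₄-pair-fort b1 b2 b3)
                         (b1 ∷ b2 ∷ b3 ∷ false ∷ [] , l₄) (dec-true ((b1 ∷ b2 ∷ b3 ∷ []) ≟ᵇ _) refl)
                         (avoids-levelwise (λ _ ()) (λ _ ()) avoid₄))
    where
    avoid₄ : ∀ w → level₄-pair b1 b2 b3 w ≡ true → hit (w , l₄) ≡ false
    avoid₄ (a ∷ b ∷ c ∷ b4 ∷ []) inPair with does-sound ((a ∷ b ∷ c ∷ []) ≟ᵇ (b1 ∷ b2 ∷ b3 ∷ [])) inPair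
    ... | refl = ∃ᵇ-false (λ b4 → hit (b1 ∷ b2 ∷ b3 ∷ b4 ∷ [] , l₄)) unhit b4

  quadrant-hit : ∀ b1 b4 → ∃□ (hitPattern hit b1 b4) ≡ true
  quadrant-hit b1 b4 with ∃□ (hitPattern hit b1 b4) in unhit
  ... | true  = refl
  ... | false = ⊥-elim (no-avoiding-fort (on-level₂ (level₂-quadrant b1 b4)) (level₂-quadrant-fort b1 b4)
                         (b1 ∷ false ∷ false ∷ b4 ∷ [] , l₂) (dec-true ((b1 ∷ b4 ∷ []) ≟ᵇ _) refl)
                         (avoids-levelwise (λ _ ()) avoid₂ (λ _ ())))
    where
    avoid₂ : ∀ w → level₂-quadrant b1 b4 w ≡ true → hit (w , l₂) ≡ false
    avoid₂ (a ∷ b2 ∷ b3 ∷ d ∷ []) inQuadrant with does-sound ((a ∷ d ∷ []) ≟ᵇ (b1 ∷ b4 ∷ [])) inQuadrant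
    ... | refl = ∃□-false (hitPattern hit b1 b4) unhit b2 b3

  quadrantClasses : Square Class
  quadrantClasses b1 b4 = classOf (hitPattern hit b1 b4)

  within-budget : length K ≤ 24 →
                  Σ□ cost quadrantClasses + (Σ□ bit (rowExcess hit) + Σ□ bit (colExcess hit)) ≤ 8
  within-budget short =
    remaining-budget (Σ□ bit (rowExcess hit)) (Σ□ bit (colExcess hit)) (Σ□ cost quadrantClasses)
                     (≤-trans (+-mono-≤ rows (+-mono-≤ cols (≤-reflexive quads))) total)
    where
    total : Σ□ (count hit) rowGadget + (Σ□ (count hit) colGadget + Σ□ (count hit) quadrant) ≤ 24
    total = subst (_≤ 24) (count-evenVertices hit)
              (≤-trans (count-endpoints (BF 4) _≟ᵥ_ evenVertices K (All.map edge-meets-evenVertices-once edges)) short)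
    rows : 8 + Σ□ bit (rowExcess hit) ≤ Σ□ (count hit) rowGadget
    rows = subst (_≤ Σ□ (count hit) rowGadget) (Σ□-2+ bit (rowExcess hit))
             (Σ□-mono (λ x → 2 + bit x) (count hit) {rowExcess hit} {rowGadget}
               (λ b3 b4 → let h = λ b1 b2 → hit (b1 ∷ b2 ∷ b3 ∷ b4 ∷ [] , l₀) in
                 gadget-count (h false false) (h true false) (h false true) (h true true)
                              (level₀-pair-hit false b3 b4) (level₀-pair-hit true b3 b4)))
    cols : 8 + Σ□ bit (colExcess hit) ≤ Σ□ (count hit) colGadget
    cols = subst (_≤ Σ□ (count hit) colGadget) (Σ□-2+ bit (colExcess hit))
             (Σ□-mono (λ x → 2 + bit x) (count hit) {colExcess hit} {colGadget}
               (λ b1 b2 → let h = λ b3 b4 → hit (b1 ∷ b2 ∷ b3 ∷ b4 ∷ [] , l₄) in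
                 gadget-count (h false false) (h false true) (h true false) (h true true)
                              (level₄-pair-hit b1 b2 false) (level₄-pair-hit b1 b2 true)))
    quads : Σ□ cost quadrantClasses ≡ Σ□ (count hit) quadrant
    quads = Σ□-cong cost (count hit) {quadrantClasses} {quadrant}
              (λ b1 b4 → cost-classOf (hitPattern hit b1 b4) (quadrant-hit b1 b4))

  impossible : length K ≤ 24 → ⊥
  impossible short = no-avoiding-fort fort isFort (proj₁ witness) (proj₂ witness) fort-avoids
    where
    found = admissible-labelling quadrantClasses (excess hit) (within-budget short)
    open Admissible (proj₂ found)
    open Model hit (proj₁ found)
      (λ b1 b4 → feasible-sound (hitPattern hit b1 b4) _ _ (quadrant-hit b1 b4) (quadrants-feasible b1 b4))
      rows-avoid cols-avoid
    witness = fort-nonempty labelled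

lemma4p4 : (K : List (Edge (BF 4))) → IsEdgeForcingSet (BF 4) K → 25 ≤ length K
lemma4p4 K (edges , _ , closed) with 25 ≤? length K
... | yes long  = long
... | no ¬long = ⊥-elim (ShortForcingSet.impossible K edges closed (ℕ.≤-pred (ℕ.≰⇒> ¬long)))
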